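{- For positive integers $m$ and $n$, the following are equivalent: (a) $m+n-4$ is a linear combination of $n-1$ and $n-2$, and $m+n-3$ is not a linear combination of $n-1$ and $n-2$; (b) $m=k(n-1)+3$ for some integer $k$ with $0\leq k\leq n-5$.
   Context: A non-negative integer $N$ is a linear combination of positive integers $p$ and $q$ if there exist non-negative integers $k,l$ with $N=kp+lq$. -}

module Defs where

open import Data.Nat using (ℕ)
open import Data.Integer using (ℤ; +_; _+_; _*_; _<_; _≤_)
open import Data.Product using (_×_; ∃₂)
open import Relation.Binary.PropositionalEquality using (_≡_)

-- "A non-negative integer N is a linear combination of positive integers p and q
--  if there exist non-negative integers k, l with N = k p + l q."
-- The standing assumptions (p, q positive, N non-negative) are part of the notion.
IsLinComb : ℤ → ℤ → ℤ → Set
IsLinComb N p q =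
  (+ 0 < p) × (+ 0 < q) × (+ 0 ≤ N) ×
  ∃₂ λ (k l : ℕ) → N ≡ (+ k) * p + (+ l) * q

{-# OPTIONS --safe #-}
module Submission where

-- Write s = n - 2, so that n - 1 = s + 1.  Since a(s+1) + bs = (a+b)s + a, the
-- combinations of s + 1 and s are exactly the numbers in the blocks
-- [ts, ts + t], t = 0, 1, 2, ….  A combination N whose successor is not one must
-- therefore end its block, N = t(s+1), and the next block must not start at N + 1,
-- i.e. t + 2 ≤ s.  With m + n - 4 = N and t = k + 1 this is condition (b).

open import Defs
open import Data.Integer using (ℤ; +_; _+_; _-_; _*_; _<_; _≤_; -[1+_]; +<+; +≤+; _⊖_)
open import Data.Integer.Properties using (pos-*; +-injective)
open import Data.Nat as ℕ using (ℕ; zero; suc; z≤n; s≤s; _≤?_; _∸_)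
open import Data.Nat.Properties
  using (suc-injective; +-suc; +-comm; +-assoc; +-identityʳ; *-suc; +-cancelʳ-≡; m+n≡0⇒n≡0;
         m≤m+n; ≤-trans; n<1+n; n≮n; ≰⇒>; m≤n⇒m<n∨m≡n; ≤-<-connex; +-monoʳ-<; +-mono-≤;
         *-monoˡ-≤; m∸n≤m; m+[n∸m]≡n; module ≤-Reasoning)
open import Data.Nat.Tactic.RingSolver using (solve-∀)
open import Data.Product using (_×_; ∃; ∃₂; ∃-syntax; _,_)
open import Data.Product.Function.NonDependent.Propositional using (_×-⇔_)
open import Data.Sum using (inj₁; inj₂)
open import Data.Empty using (⊥-elim)
open import Function.Bundles using (_⇔_; mk⇔; Equivalence)
open import Function.Properties.Equivalence using () renaming (trans to ⇔-trans; sym to ⇔-sym)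
open import Function.Related.TypeIsomorphisms using (¬-cong-⇔)
open import Relation.Nullary using (¬_; yes; no)
open import Relation.Binary.PropositionalEquality
  using (_≡_; refl; sym; trans; cong; cong₂; module ≡-Reasoning)

IsLinCombℕ : ℕ → ℕ → ℕ → Set
IsLinCombℕ N p q = ∃₂ λ (a b : ℕ) → N ≡ a ℕ.* p ℕ.+ b ℕ.* q

isLinComb⇔isLinCombℕ : ∀ N p q →
  IsLinComb (+ N) (+ suc p) (+ suc q) ⇔ IsLinCombℕ N (suc p) (suc q)
isLinComb⇔isLinCombℕ N p q = mk⇔
  (λ (_ , _ , _ , a , b , eq) → a , b , +-injective (trans eq (sym (cast a b))))
  (λ (a , b , eq) → +<+ (s≤s z≤n) , +<+ (s≤s z≤n) , +≤+ z≤n , a , b , trans (cong +_ eq) (cast a b))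
  where
  cast : ∀ a b → + (a ℕ.* suc p ℕ.+ b ℕ.* suc q) ≡ + a * + suc p + + b * + suc q
  cast a b = cong₂ _+_ (pos-* a (suc p)) (pos-* b (suc q))

a*[1+s]+b*s≡[a+b]*s+a : ∀ a b s → a ℕ.* suc s ℕ.+ b ℕ.* s ≡ (a ℕ.+ b) ℕ.* s ℕ.+ a
a*[1+s]+b*s≡[a+b]*s+a = solve-∀

isLinCombℕ-consecutive⇔ : ∀ N s →
  IsLinCombℕ N (suc s) s ⇔ ∃₂ λ t r → r ℕ.≤ t × N ≡ t ℕ.* s ℕ.+ r
isLinCombℕ-consecutive⇔ N s = mk⇔
  (λ (a , b , eq) → a ℕ.+ b , a , m≤m+n a b , trans eq (a*[1+s]+b*s≡[a+b]*s+a a b s))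
  (λ where (t , r , r≤t , refl) → split r≤t)
  where
  split : ∀ {t r} → r ℕ.≤ t → IsLinCombℕ (t ℕ.* s ℕ.+ r) (suc s) s
  split {t} {r} r≤t = r , t ∸ r , sym (begin
    r ℕ.* suc s ℕ.+ (t ∸ r) ℕ.* s   ≡⟨ a*[1+s]+b*s≡[a+b]*s+a r (t ∸ r) s ⟩
    (r ℕ.+ (t ∸ r)) ℕ.* s ℕ.+ r     ≡⟨ cong (λ x → x ℕ.* s ℕ.+ r) (m+[n∸m]≡n r≤t) ⟩
    t ℕ.* s ℕ.+ r                   ∎)
    where open ≡-Reasoning

t*[1+s]≡t*s+t : ∀ t s → t ℕ.* suc s ≡ t ℕ.* s ℕ.+ t
t*[1+s]≡t*s+t t s = trans (*-suc t s) (+-comm t (t ℕ.* s))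

gap-after-block : ∀ {s t} → 2 ℕ.+ t ℕ.≤ s → ¬ IsLinCombℕ (suc (t ℕ.* suc s)) (suc s) s
gap-after-block {s} {t} 2+t≤s rep
  with u , r , r≤u , eq ← Equivalence.to (isLinCombℕ-consecutive⇔ _ s) rep
  with ≤-<-connex u t
... | inj₁ u≤t = n≮n _ (begin-strict
  t ℕ.* suc s          <⟨ n<1+n _ ⟩
  suc (t ℕ.* suc s)    ≡⟨ eq ⟩
  u ℕ.* s ℕ.+ r        ≤⟨ +-mono-≤ (*-monoˡ-≤ s u≤t) (≤-trans r≤u u≤t) ⟩
  t ℕ.* s ℕ.+ t        ≡⟨ sym (t*[1+s]≡t*s+t t s) ⟩
  t ℕ.* suc s          ∎)
  where open ≤-Reasoning
... | inj₂ t<u = n≮n _ (begin-strict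
  suc (t ℕ.* suc s)    ≡⟨ cong suc (t*[1+s]≡t*s+t t s) ⟩
  suc (t ℕ.* s ℕ.+ t)  ≡⟨ sym (+-suc (t ℕ.* s) t) ⟩
  t ℕ.* s ℕ.+ suc t    <⟨ +-monoʳ-< (t ℕ.* s) 2+t≤s ⟩
  t ℕ.* s ℕ.+ s        ≡⟨ +-comm (t ℕ.* s) s ⟩
  suc t ℕ.* s          ≤⟨ *-monoˡ-≤ s t<u ⟩
  u ℕ.* s              ≤⟨ m≤m+n (u ℕ.* s) r ⟩
  u ℕ.* s ℕ.+ r        ≡⟨ sym eq ⟩
  suc (t ℕ.* suc s)    ∎)
  where open ≤-Reasoning

block-end-before-gap : ∀ {N s} → IsLinCombℕ N (suc s) s → ¬ IsLinCombℕ (suc N) (suc s) s →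
  ∃ λ t → N ≡ t ℕ.* suc s × 2 ℕ.+ t ℕ.≤ s
block-end-before-gap {s = s} rep gap
  with t , r , r≤t , refl ← Equivalence.to (isLinCombℕ-consecutive⇔ _ s) rep
  with m≤n⇒m<n∨m≡n r≤t
... | inj₁ r<t =
  ⊥-elim (gap (Equivalence.from (isLinCombℕ-consecutive⇔ _ s)
    (t , suc r , r<t , sym (+-suc (t ℕ.* s) r))))
... | inj₂ refl with s ≤? suc r
...   | no s≰1+r = r , sym (t*[1+s]≡t*s+t r s) , ≰⇒> s≰1+r
...   | yes s≤1+r =
  ⊥-elim (gap (Equivalence.from (isLinCombℕ-consecutive⇔ _ s)
    (suc r , suc r ∸ s , m∸n≤m (suc r) s , next-block)))
  where
  open ≡-Reasoning
  next-block : suc (r ℕ.* s ℕ.+ r) ≡ suc r ℕ.* s ℕ.+ (suc r ∸ s)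
  next-block = begin
    suc (r ℕ.* s ℕ.+ r)            ≡⟨ sym (+-suc (r ℕ.* s) r) ⟩
    r ℕ.* s ℕ.+ suc r              ≡⟨ cong (r ℕ.* s ℕ.+_) (sym (m+[n∸m]≡n s≤1+r)) ⟩
    r ℕ.* s ℕ.+ (s ℕ.+ (suc r ∸ s)) ≡⟨ sym (+-assoc (r ℕ.* s) s _) ⟩
    r ℕ.* s ℕ.+ s ℕ.+ (suc r ∸ s)  ≡⟨ cong (ℕ._+ (suc r ∸ s)) (+-comm (r ℕ.* s) s) ⟩
    suc r ℕ.* s ℕ.+ (suc r ∸ s)    ∎

isLinCombℕ-before-gap⇔ : ∀ N s →
  (IsLinCombℕ N (suc s) s × ¬ IsLinCombℕ (suc N) (suc s) s) ⇔
  (∃ λ t → N ≡ t ℕ.* suc s × 2 ℕ.+ t ℕ.≤ s)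
isLinCombℕ-before-gap⇔ N s = mk⇔
  (λ (rep , gap) → block-end-before-gap rep gap)
  (λ where (t , refl , 2+t≤s) → (t , 0 , sym (+-identityʳ _)) , gap-after-block 2+t≤s)

1+[k+1]*[2+j]≡k*[2+j]+3+j : ∀ k j → suc (suc k ℕ.* (2 ℕ.+ j)) ≡ k ℕ.* (2 ℕ.+ j) ℕ.+ 3 ℕ.+ j
1+[k+1]*[2+j]≡k*[2+j]+3+j = solve-∀

shift-block-index⇔ : ∀ m j →
  (∃ λ t → m ℕ.+ j ≡ t ℕ.* (2 ℕ.+ j) × 2 ℕ.+ t ℕ.≤ suc j) ⇔
  (∃ λ k → suc m ≡ k ℕ.* (2 ℕ.+ j) ℕ.+ 3 × 2 ℕ.+ k ℕ.≤ j)
shift-block-index⇔ m j = mk⇔ to from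
  where
  to : (∃ λ t → m ℕ.+ j ≡ t ℕ.* (2 ℕ.+ j) × 2 ℕ.+ t ℕ.≤ suc j) →
       (∃ λ k → suc m ≡ k ℕ.* (2 ℕ.+ j) ℕ.+ 3 × 2 ℕ.+ k ℕ.≤ j)
  to (zero , m+j≡0 , s≤s (s≤s _)) with () ← m+n≡0⇒n≡0 m m+j≡0
  to (suc k , eq , s≤s 2+k≤j) =
    k , +-cancelʳ-≡ j (suc m) _ (trans (cong suc eq) (1+[k+1]*[2+j]≡k*[2+j]+3+j k j)) , 2+k≤j
  from : (∃ λ k → suc m ≡ k ℕ.* (2 ℕ.+ j) ℕ.+ 3 × 2 ℕ.+ k ℕ.≤ j) →
         (∃ λ t → m ℕ.+ j ≡ t ℕ.* (2 ℕ.+ j) × 2 ℕ.+ t ℕ.≤ suc j)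
  from (k , eq , 2+k≤j) =
    suc k , suc-injective (trans (cong (ℕ._+ j) eq) (sym (1+[k+1]*[2+j]≡k*[2+j]+3+j k j))) , s≤s 2+k≤j

+k≤+[3+j]-5⇔2+k≤j : ∀ k j → + k ≤ + (3 ℕ.+ j) - + 5 ⇔ 2 ℕ.+ k ℕ.≤ j
+k≤+[3+j]-5⇔2+k≤j k zero = mk⇔ (λ ()) (λ ())
+k≤+[3+j]-5⇔2+k≤j k (suc zero) = mk⇔ (λ ()) (λ { (s≤s ()) })
+k≤+[3+j]-5⇔2+k≤j k (suc (suc i)) =
  mk⇔ (λ { (+≤+ k≤i) → s≤s (s≤s k≤i) }) (λ { (s≤s (s≤s k≤i)) → +≤+ k≤i })

∃ℤ-witness⇔∃ℕ-witness : ∀ m j →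
  (∃[ k ] (+ suc m ≡ k * + (2 ℕ.+ j) + + 3 × + 0 ≤ k × k ≤ + (3 ℕ.+ j) - + 5)) ⇔
  (∃ λ k → suc m ≡ k ℕ.* (2 ℕ.+ j) ℕ.+ 3 × 2 ℕ.+ k ℕ.≤ j)
∃ℤ-witness⇔∃ℕ-witness m j = mk⇔
  (λ { (+ k , eq , _ , k≤) →
         k , +-injective (trans eq (sym (cast k))) , Equivalence.to (+k≤+[3+j]-5⇔2+k≤j k j) k≤ })
  (λ (k , eq , 2+k≤j) →
     + k , trans (cong +_ eq) (cast k) , +≤+ z≤n , Equivalence.from (+k≤+[3+j]-5⇔2+k≤j k j) 2+k≤j)
  where
  cast : ∀ k → + (k ℕ.* (2 ℕ.+ j) ℕ.+ 3) ≡ + k * + (2 ℕ.+ j) + + 3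
  cast k = cong (_+ + 3) (pos-* k (2 ℕ.+ j))

[1+m]+[3+j]≡4+[m+j] : ∀ m j → suc m ℕ.+ (3 ℕ.+ j) ≡ 4 ℕ.+ (m ℕ.+ j)
[1+m]+[3+j]≡4+[m+j] = solve-∀

+[1+m]+[3+j]-4≡m+j : ∀ m j → + suc m + + (3 ℕ.+ j) - + 4 ≡ + (m ℕ.+ j)
+[1+m]+[3+j]-4≡m+j m j = cong (_⊖ 4) ([1+m]+[3+j]≡4+[m+j] m j)

+[1+m]+[3+j]-3≡1+m+j : ∀ m j → + suc m + + (3 ℕ.+ j) - + 3 ≡ + suc (m ℕ.+ j)
+[1+m]+[3+j]-3≡1+m+j m j = cong (_⊖ 3) ([1+m]+[3+j]≡4+[m+j] m j)

fact4p1 : (m n : ℤ) → + 0 < m → + 0 < n →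
    ((IsLinComb (m + n - + 4) (n - + 1) (n - + 2) × ¬ IsLinComb (m + n - + 3) (n - + 1) (n - + 2))
      ⇔ (∃[ k ] (m ≡ k * (n - + 1) + + 3 × + 0 ≤ k × k ≤ n - + 5)))
fact4p1 -[1+ _ ] n () _
fact4p1 (+ 0) n (+<+ ()) _
fact4p1 m -[1+ _ ] _ ()
fact4p1 m (+ 0) _ (+<+ ())
fact4p1 m (+ 1) _ _ = mk⇔ (λ { ((_ , () , _) , _) }) (λ { (_ , _ , +≤+ _ , ()) })
fact4p1 m (+ 2) _ _ = mk⇔ (λ { ((_ , +<+ () , _) , _) }) (λ { (_ , _ , +≤+ _ , ()) })
fact4p1 (+ suc m) (+ suc (suc (suc j))) _ _
  rewrite +[1+m]+[3+j]-4≡m+j m j | +[1+m]+[3+j]-3≡1+m+j m j =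
  ⇔-trans (isLinComb⇔isLinCombℕ _ _ _ ×-⇔ ¬-cong-⇔ (isLinComb⇔isLinCombℕ _ _ _))
  (⇔-trans (isLinCombℕ-before-gap⇔ (m ℕ.+ j) (suc j))
  (⇔-trans (shift-block-index⇔ m j) (⇔-sym (∃ℤ-witness⇔∃ℕ-witness m j))))
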